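{- For every odd integer $n\geq 3$, every integer $t$ with $3\le t\le n$, and every nonnegative integer $l$, there exists an SFD$(t,n)$ whose set of entries is $\{1+l,2+l,\dots,nt+l\}$.
   Context: For an integer $a$ and a positive integer $n$, $\langle a\rangle_n$ denotes the unique element of $\{1,\dots,n\}$ congruent to $a$ modulo $n$. For a $t\times n$ array $A=(a_{i,j})$, the forward diagonals are, for each $j\in\{1,\dots,n\}$, the sets of entries $\{a_{i,\langle j+i\rangle_n}: i=1,\dots,t\}$. A $t\times n$ array $A=(a_{i,j})$ with $t\le n$ is a symmetric forward diagonals array, SFD$(t,n)$, if: (1) its entries are $nt$ consecutive positive integers (each occurring once); (2) all columns have the same sum; (3) all forward diagonals have the same sum; (4) $a_{i,j}+a_{t+1-i,n+1-j}$ is a constant independent of $(i,j)$. -}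

module Defs where

open import Data.Nat using (ℕ; zero; suc; _+_; _*_; _≤_; _<_)
open import Data.Nat.DivMod using (_%_; m%n<n)
open import Data.Fin using (Fin; toℕ; fromℕ<; opposite) renaming (zero to fzero; suc to fsuc)
open import Data.Product using (Σ; _×_; _,_; ∃)
open import Relation.Binary.PropositionalEquality using (_≡_)

Σ[<_]_ : (m : ℕ) → (Fin m → ℕ) → ℕ
Σ[< zero ] f = 0
Σ[< suc m ] f = f fzero + Σ[< m ] (λ i → f (fsuc i))

-- A t×n array with natural-number entries; rows/columns 0-indexed
-- (row i : Fin t stands for row i+1 of the paper, likewise for columns).
Array : ℕ → ℕ → Set
Array t n = Fin t → Fin n → ℕ

colSum : ∀ {t n} → Array t n → Fin n → ℕ
colSum {t} A j = Σ[< t ] (λ i → A i j)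

-- Column index of the entry of forward diagonal j in row i.
-- Paper (1-indexed): column ⟨j+i⟩_n for row i.  With 0-indexed i' = i-1,
-- j' = j-1, the 0-indexed column is (j' + i' + 1) mod n.
diagCol : ∀ {n} → Fin n → ℕ → Fin n
diagCol {zero} ()
diagCol {suc n} j i = fromℕ< (m%n<n (toℕ j + i + 1) (suc n))

diagSum : ∀ {t n} → Array t n → Fin n → ℕ
diagSum {t} A j = Σ[< t ] (λ i → A i (diagCol j (toℕ i)))

record IsSFDShifted (t n l : ℕ) (A : Array t n) : Set where
  field
    t≤n         : t ≤ n
    entries-in  : ∀ i j → (1 + l ≤ A i j) × (A i j ≤ n * t + l)
    entries-inj : ∀ i j i′ j′ → A i j ≡ A i′ j′ → (i ≡ i′) × (j ≡ j′)
    entries-onto : ∀ v → 1 + l ≤ v → v ≤ n * t + l →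
                   Σ (Fin t) (λ i → Σ (Fin n) (λ j → A i j ≡ v))
    columns     : ∃ λ c → ∀ j → colSum A j ≡ c
    diagonals   : ∃ λ d → ∀ j → diagSum A j ≡ d
    symmetric   : ∃ λ s → ∀ i j → A i j + A (opposite i) (opposite j) ≡ s

-- Write n = 2m + 1 and put 1 + l + i + t · σᵢ(j) in row i, column j, where every σᵢ permutes the
-- residues {0, …, 2m} of j mod n.  As base-t numerals these entries are exactly 1 + l, …, nt + l,
-- and the remaining three conditions reduce to Σᵢ σᵢ(j) = Σᵢ σᵢ(i + j + 1) = tm for all j and
-- σ_{t−1−i}(2m − j) = 2m − σᵢ(j).  The σᵢ are taken from the identity I, halving H (multiplication
-- by 2⁻¹ mod n), its shift H′ = H(· − 1) and their complements 2m − σ; since H + H′ = I + m and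
-- H′(· + 1) = H, the sums telescope for the patterns  H, −I, I, −I, …, I, −I, H′  (every odd t)
-- and  H, −H′, −H, H′  (t = 4).  A pattern stacked on top of itself is again a pattern, which
-- yields every even t ≥ 6 from a smaller one.

module Submission where

open import Data.Nat
  using (ℕ; zero; suc; _+_; _*_; _∸_; _≤_; _<_; _≤?_; z≤n; s≤s; z<s; NonZero; >-nonZero; pred; _%_; _/_)
open import Data.Nat.Properties
open import Data.Nat.DivMod
open import Data.Nat.Induction using (<-rec)
open import Data.Nat.Tactic.RingSolver using (solve-∀)
open import Data.Fin using (Fin; toℕ; fromℕ<; opposite) renaming (zero to fzero; suc to fsuc)
open import Data.Fin.Properties using (toℕ<n; toℕ-fromℕ<; toℕ-injective; opposite-prop)
open import Data.Product using (Σ; _×_; _,_; proj₁; proj₂)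
open import Data.Sum using (inj₁; inj₂)
open import Function using (_∘_)
open import Relation.Nullary using (yes; no; contradiction)
open import Relation.Binary.PropositionalEquality
open ≡-Reasoning

open import Defs

Σ[<]-cong : ∀ t {f g : Fin t → ℕ} → (∀ i → f i ≡ g i) → Σ[< t ] f ≡ Σ[< t ] g
Σ[<]-cong zero    _   = refl
Σ[<]-cong (suc t) f≗g = cong₂ _+_ (f≗g fzero) (Σ[<]-cong t (f≗g ∘ fsuc))

Σ[<]-+-* : ∀ t (f g : Fin t → ℕ) c →
           Σ[< t ] (λ i → f i + g i * c) ≡ Σ[< t ] f + Σ[< t ] g * c
Σ[<]-+-* zero    f g c = refl
Σ[<]-+-* (suc t) f g c = begin
  f fzero + g fzero * c + Σ[< t ] (λ i → f (fsuc i) + g (fsuc i) * c)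
    ≡⟨ cong (f fzero + g fzero * c +_) (Σ[<]-+-* t (f ∘ fsuc) (g ∘ fsuc) c) ⟩
  f fzero + g fzero * c + (Σ[< t ] (f ∘ fsuc) + Σ[< t ] (g ∘ fsuc) * c)
    ≡⟨ regroup (f fzero) (g fzero) (Σ[< t ] (f ∘ fsuc)) (Σ[< t ] (g ∘ fsuc)) c ⟩
  f fzero + Σ[< t ] (f ∘ fsuc) + (g fzero + Σ[< t ] (g ∘ fsuc)) * c ∎
  where
  regroup : ∀ a b F G c → a + b * c + (F + G * c) ≡ a + F + (b + G) * c
  regroup = solve-∀

toℕ+toℕ-opposite : ∀ {t} (i : Fin t) → toℕ i + suc (toℕ (opposite i)) ≡ t
toℕ+toℕ-opposite {t} i = begin
  toℕ i + suc (toℕ (opposite i)) ≡⟨ +-suc (toℕ i) _ ⟩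
  suc (toℕ i + toℕ (opposite i)) ≡⟨ cong (λ k → suc (toℕ i + k)) (opposite-prop i) ⟩
  suc (toℕ i) + (t ∸ suc (toℕ i)) ≡⟨ m+[n∸m]≡n (toℕ<n i) ⟩
  t                              ∎

digits-injective : ∀ {t i i′} x x′ .{{_ : NonZero t}} → i < t → i′ < t →
                   i + x * t ≡ i′ + x′ * t → i ≡ i′ × x ≡ x′
digits-injective {t} {i} {i′} x x′ i<t i′<t e =
  i≡i′ , *-cancelʳ-≡ x x′ t (+-cancelˡ-≡ i _ _ (trans e (cong (_+ x′ * t) (sym i≡i′))))
  where
  i≡i′ : i ≡ i′
  i≡i′ = begin
    i                 ≡⟨ m<n⇒m%n≡m i<t ⟨
    i % t             ≡⟨ [m+kn]%n≡m%n i x t ⟨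
    (i + x * t) % t   ≡⟨ cong (_% t) e ⟩
    (i′ + x′ * t) % t ≡⟨ [m+kn]%n≡m%n i′ x′ t ⟩
    i′ % t            ≡⟨ m<n⇒m%n≡m i′<t ⟩
    i′                ∎

+≡⇒∸≡ : ∀ a b {c} → a + b ≡ c → c ∸ a ≡ b
+≡⇒∸≡ a b refl = m+n∸m≡n a b

data Parity : ℕ → Set where
  even : ∀ k → Parity (k * 2)
  odd  : ∀ k → Parity (suc (k * 2))

parity : ∀ w → Parity w
parity zero          = even zero
parity (suc zero)    = odd zero
parity (suc (suc w)) with parity w
... | even k = even (suc k)
... | odd  k = odd (suc k)

record RangePerm (N : ℕ) : Set where
  field
    to from : ℕ → ℕ
    to-≤    : ∀ {w} → w ≤ N → to w ≤ N
    from-≤  : ∀ {w} → w ≤ N → from w ≤ N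
    to-from : ∀ {w} → w ≤ N → to (from w) ≡ w
    from-to : ∀ {w} → w ≤ N → from (to w) ≡ w

module _ {N : ℕ} where
  open RangePerm

  idᴿ : RangePerm N
  idᴿ = record { to = λ w → w ; from = λ w → w ; to-≤ = λ w≤N → w≤N ; from-≤ = λ w≤N → w≤N
               ; to-from = λ _ → refl ; from-to = λ _ → refl }

  reflectᴿ : RangePerm N
  reflectᴿ = record { to = N ∸_ ; from = N ∸_ ; to-≤ = λ {w} _ → m∸n≤m N w ; from-≤ = λ {w} _ → m∸n≤m N w
                    ; to-from = m∸[m∸n]≡n ; from-to = m∸[m∸n]≡n }

  _∘ᴿ_ : RangePerm N → RangePerm N → RangePerm N
  p ∘ᴿ q = record
    { to      = to p ∘ to q
    ; from    = from q ∘ from p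
    ; to-≤    = to-≤ p ∘ to-≤ q
    ; from-≤  = from-≤ q ∘ from-≤ p
    ; to-from = λ w≤N → trans (cong (to p) (to-from q (from-≤ p w≤N))) (to-from p w≤N)
    ; from-to = λ w≤N → trans (cong (from q) (from-to p (to-≤ q w≤N))) (from-to q w≤N)
    }

  withTo : (p : RangePerm N) (f : ℕ → ℕ) → (∀ {w} → w ≤ N → f w ≡ to p w) → RangePerm N
  withTo p f f≗p = record
    { to      = f
    ; from    = from p
    ; to-≤    = λ w≤N → subst (_≤ N) (sym (f≗p w≤N)) (to-≤ p w≤N)
    ; from-≤  = from-≤ p
    ; to-from = λ w≤N → trans (f≗p (from-≤ p w≤N)) (to-from p w≤N)
    ; from-to = λ w≤N → trans (cong (from p) (f≗p w≤N)) (from-to p w≤N)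
    }

module Modulus (m : ℕ) where

  M n : ℕ
  M = m * 2
  n = suc M

  M≡m+m : M ≡ m + m
  M≡m+m = trans (*-comm m 2) (cong (m +_) (+-identityʳ m))

  -- half w ≡ w · 2⁻¹ (mod n), and half′ w ≡ half (w − 1) (mod n).
  half : ℕ → ℕ
  half zero          = zero
  half (suc zero)    = suc m
  half (suc (suc w)) = suc (half w)

  half′ : ℕ → ℕ
  half′ zero    = m
  half′ (suc w) = half w

  half-even : ∀ k → half (k * 2) ≡ k
  half-even zero    = refl
  half-even (suc k) = cong suc (half-even k)

  half-odd : ∀ k → half (suc (k * 2)) ≡ suc (m + k)
  half-odd zero    = cong suc (sym (+-identityʳ m))
  half-odd (suc k) = cong suc (trans (half-odd k) (sym (+-suc m k)))

  half-suc : ∀ w → half (suc w) ≡ suc (half′ w)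
  half-suc zero    = refl
  half-suc (suc w) = refl

  half+half′ : ∀ w → half w + half′ w ≡ w + m
  half+half′ zero    = refl
  half+half′ (suc w) = consecutive w
    where
    consecutive : ∀ w → half (suc w) + half w ≡ suc (w + m)
    consecutive zero    = cong suc (+-identityʳ m)
    consecutive (suc w) = cong suc (trans (+-comm (half w) (half (suc w))) (consecutive w))

  half+half′-complement : ∀ a b → a + b ≡ M → half a + half′ b ≡ M
  half+half′-complement zero b refl =
    +-cancelˡ-≡ m _ _ (begin
      m + half′ M      ≡⟨ cong (_+ half′ M) (half-even m) ⟨
      half M + half′ M ≡⟨ half+half′ M ⟩
      M + m            ≡⟨ +-comm M m ⟩
      m + M            ∎)
  half+half′-complement (suc zero) b 1+b≡M = begin
    suc (m + half′ b) ≡⟨ +-suc m (half′ b) ⟨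
    m + suc (half′ b) ≡⟨ cong (m +_) (half-suc b) ⟨
    m + half (suc b)  ≡⟨ cong (λ w → m + half w) 1+b≡M ⟩
    m + half M        ≡⟨ cong (m +_) (half-even m) ⟩
    m + m             ≡⟨ M≡m+m ⟨
    M                 ∎
  half+half′-complement (suc (suc a)) b 2+a+b≡M = begin
    suc (half a + half′ b)       ≡⟨ +-suc (half a) (half′ b) ⟨
    half a + suc (half′ b)       ≡⟨ cong (half a +_) (half-suc b) ⟨
    half a + half′ (suc (suc b)) ≡⟨ half+half′-complement a (suc (suc b)) a+2+b≡M ⟩
    M                            ∎
    where
    a+2+b≡M : a + suc (suc b) ≡ M
    a+2+b≡M = trans (+-suc a (suc b)) (trans (cong suc (+-suc a b)) 2+a+b≡M)

  half-≤ : ∀ {w} → w ≤ M → half w ≤ M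
  half-≤ {w} w≤M with parity w
  ... | even k = subst (_≤ M) (sym (half-even k)) (≤-trans (m≤m*n k 2) w≤M)
  ... | odd k  = subst (_≤ M) (sym (half-odd k)) 1+m+k≤M
    where
    k<m : k < m
    k<m = *-cancelʳ-< 2 k m w≤M
    1+m+k≤M : suc (m + k) ≤ M
    1+m+k≤M = subst₂ _≤_ (+-suc m k) (sym M≡m+m) (+-monoʳ-≤ m k<m)

  double : ℕ → ℕ
  double q with q ≤? m
  ... | yes _ = q * 2
  ... | no  _ = suc ((q ∸ suc m) * 2)

  double-≤ : ∀ {q} → q ≤ M → double q ≤ M
  double-≤ {q} q≤M with q ≤? m
  ... | yes q≤m = *-monoˡ-≤ 2 q≤m
  ... | no  q≰m = *-monoˡ-< 2 q∸1+m<m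
    where
    q∸1+m<m : q ∸ suc m < m
    q∸1+m<m = +-cancelˡ-< (suc m) (q ∸ suc m) m
                (subst₂ _<_ (sym (m+[n∸m]≡n (≰⇒> q≰m))) (cong suc M≡m+m) (s≤s q≤M))

  half-double : ∀ {q} → q ≤ M → half (double q) ≡ q
  half-double {q} _ with q ≤? m
  ... | yes _   = half-even q
  ... | no  q≰m = trans (half-odd (q ∸ suc m)) (m+[n∸m]≡n (≰⇒> q≰m))

  double-half : ∀ {w} → w ≤ M → double (half w) ≡ w
  double-half {w} w≤M with parity w
  ... | even k rewrite half-even k with k ≤? m
  ...   | yes _   = refl
  ...   | no  k≰m = contradiction (*-cancelʳ-≤ k m 2 w≤M) k≰m
  double-half {w} w≤M | odd k rewrite half-odd k with suc (m + k) ≤? m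
  ...   | yes 1+m+k≤m = contradiction 1+m+k≤m (<⇒≱ (s≤s (m≤m+n m k)))
  ...   | no  _       = cong (λ j → suc (j * 2)) (m+n∸m≡n m k)

  half′-reflect : ∀ {w} → w ≤ M → half′ w ≡ M ∸ half (M ∸ w)
  half′-reflect {w} w≤M =
    sym (+≡⇒∸≡ (half (M ∸ w)) (half′ w) (half+half′-complement (M ∸ w) w (m∸n+n≡m w≤M)))

  halfᴿ half′ᴿ : RangePerm M
  halfᴿ = record { to = half ; from = double ; to-≤ = half-≤ ; from-≤ = double-≤
                 ; to-from = half-double ; from-to = double-half }
  half′ᴿ = withTo (reflectᴿ ∘ᴿ (halfᴿ ∘ᴿ reflectᴿ)) half′ half′-reflect

  data Base : Set where
    I H H′ : Base

  data Row : Set where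
    ⊕_ ⊖_ : Base → Row

  baseᴿ : Base → RangePerm M
  baseᴿ I  = idᴿ
  baseᴿ H  = halfᴿ
  baseᴿ H′ = half′ᴿ

  rowᴿ : Row → RangePerm M
  rowᴿ (⊕ b) = baseᴿ b
  rowᴿ (⊖ b) = reflectᴿ ∘ᴿ baseᴿ b

  ⟦_⟧ : Row → ℕ → ℕ
  ⟦ r ⟧ v = RangePerm.to (rowᴿ r) (v % n)

  dualBase : Base → Base
  dualBase I  = I
  dualBase H  = H′
  dualBase H′ = H

  dual : Row → Row
  dual (⊕ b) = ⊕ dualBase b
  dual (⊖ b) = ⊖ dualBase b

  %n≤M : ∀ v → v % n ≤ M
  %n≤M v = <⇒≤pred (m%n<n v n)

  ⟦⟧-≤ : ∀ r v → ⟦ r ⟧ v ≤ M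
  ⟦⟧-≤ r v = RangePerm.to-≤ (rowᴿ r) (%n≤M v)

  ⟦⟧-% : ∀ r v → ⟦ r ⟧ (v % n) ≡ ⟦ r ⟧ v
  ⟦⟧-% r v = cong (RangePerm.to (rowᴿ r)) (m%n%n≡m%n v n)

  ⟦⟧-residue : ∀ r {w} → w ≤ M → ⟦ r ⟧ w ≡ RangePerm.to (rowᴿ r) w
  ⟦⟧-residue r w≤M = cong (RangePerm.to (rowᴿ r)) (m≤n⇒m%n≡m w≤M)

  ⟦⟧-injective : ∀ r {a b} → a < n → b < n → ⟦ r ⟧ a ≡ ⟦ r ⟧ b → a ≡ b
  ⟦⟧-injective r {a} {b} a<n b<n e = begin
    a                      ≡⟨ from-to (<⇒≤pred a<n) ⟨
    from (to a)            ≡⟨ cong from (⟦⟧-residue r (<⇒≤pred a<n)) ⟨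
    from (⟦ r ⟧ a)         ≡⟨ cong from e ⟩
    from (⟦ r ⟧ b)         ≡⟨ cong from (⟦⟧-residue r (<⇒≤pred b<n)) ⟩
    from (to b)            ≡⟨ from-to (<⇒≤pred b<n) ⟩
    b                      ∎
    where open RangePerm (rowᴿ r)

  ⟦⟧-surjective : ∀ r {q} → q ≤ M → Σ (Fin n) (λ j → ⟦ r ⟧ (toℕ j) ≡ q)
  ⟦⟧-surjective r {q} q≤M = fromℕ< (s≤s (from-≤ q≤M)) , (begin
    ⟦ r ⟧ (toℕ (fromℕ< (s≤s (from-≤ q≤M)))) ≡⟨ cong ⟦ r ⟧ (toℕ-fromℕ< (s≤s (from-≤ q≤M))) ⟩
    ⟦ r ⟧ (from q)                          ≡⟨ ⟦⟧-residue r (from-≤ q≤M) ⟩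
    to (from q)                             ≡⟨ to-from q≤M ⟩
    q                                       ∎)
    where open RangePerm (rowᴿ r)

  baseᴿ-dual : ∀ b {w} → w ≤ M →
               RangePerm.to (baseᴿ b) w + RangePerm.to (baseᴿ (dualBase b)) (M ∸ w) ≡ M
  baseᴿ-dual I  w≤M = m+[n∸m]≡n w≤M
  baseᴿ-dual H  {w} w≤M = half+half′-complement w (M ∸ w) (m+[n∸m]≡n w≤M)
  baseᴿ-dual H′ {w} w≤M =
    trans (+-comm (half′ w) _) (half+half′-complement (M ∸ w) w (m∸n+n≡m w≤M))

  ⟦⟧-dual : ∀ r {w} → w ≤ M → ⟦ r ⟧ w + ⟦ dual r ⟧ (M ∸ w) ≡ M
  ⟦⟧-dual r {w} w≤M = trans (cong₂ _+_ (⟦⟧-residue r w≤M) (⟦⟧-residue (dual r) (m∸n≤m M w))) (dual-to r)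
    where
    dual-to : ∀ r → RangePerm.to (rowᴿ r) w + RangePerm.to (rowᴿ (dual r)) (M ∸ w) ≡ M
    dual-to (⊕ b) = baseᴿ-dual b w≤M
    dual-to (⊖ b) = begin
      (M ∸ x) + (M ∸ y) ≡⟨ cong₂ _+_ (+≡⇒∸≡ x y x+y≡M) (+≡⇒∸≡ y x (trans (+-comm y x) x+y≡M)) ⟩
      y + x             ≡⟨ trans (+-comm y x) x+y≡M ⟩
      M                 ∎
      where
      x = RangePerm.to (baseᴿ b) w
      y = RangePerm.to (baseᴿ (dualBase b)) (M ∸ w)
      x+y≡M : x + y ≡ M
      x+y≡M = baseᴿ-dual b w≤M

  M+-unfold : ∀ x → M + x ≡ m + (m + x)
  M+-unfold x = trans (cong (_+ x) M≡m+m) (+-assoc m m x)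

  suc-% : ∀ v → suc v % n ≡ suc (v % n) % n
  suc-% v = trans (cong (λ x → suc x % n) (m≡m%n+[m/n]*n v n)) ([m+kn]%n≡m%n (suc (v % n)) (v / n) n)

  ⟦H′⟧-suc : ∀ v → ⟦ ⊕ H′ ⟧ (suc v) ≡ ⟦ ⊕ H ⟧ v
  ⟦H′⟧-suc v with m≤n⇒m<n∨m≡n (%n≤M v)
  ... | inj₁ v%n<M = cong half′ (trans (suc-% v) (m≤n⇒m%n≡m v%n<M))
  ... | inj₂ v%n≡M = begin
    half′ (suc v % n) ≡⟨ cong half′ (trans (suc-% v) (trans (cong (λ w → suc w % n) v%n≡M) (n%n≡0 n))) ⟩
    m                 ≡⟨ half-even m ⟨
    half M            ≡⟨ cong half v%n≡M ⟨
    half (v % n)      ∎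

  ⟦H⟧-consecutive : ∀ v → ⟦ ⊕ H ⟧ v + ⟦ ⊕ H ⟧ (suc v) ≡ suc v % n + m
  ⟦H⟧-consecutive v = begin
    ⟦ ⊕ H ⟧ v + ⟦ ⊕ H ⟧ (suc v)        ≡⟨ cong (_+ ⟦ ⊕ H ⟧ (suc v)) (⟦H′⟧-suc v) ⟨
    ⟦ ⊕ H′ ⟧ (suc v) + ⟦ ⊕ H ⟧ (suc v) ≡⟨ +-comm (⟦ ⊕ H′ ⟧ (suc v)) _ ⟩
    ⟦ ⊕ H ⟧ (suc v) + ⟦ ⊕ H′ ⟧ (suc v) ≡⟨ half+half′ (suc v % n) ⟩
    suc v % n + m                      ∎

  ⟦H⟧-step : ∀ v → ⟦ ⊕ H ⟧ v + suc (suc v) % n ≡ ⟦ ⊕ H ⟧ (suc (suc v)) + suc v % n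
  ⟦H⟧-step v = +-cancelʳ-≡ (b + m) (a + r₂) (c + r₁) (begin
    (a + r₂) + (b + m) ≡⟨ swap₁ a r₂ b m ⟩
    (a + b) + (r₂ + m) ≡⟨ cong₂ _+_ (⟦H⟧-consecutive v) (sym (⟦H⟧-consecutive (suc v))) ⟩
    (r₁ + m) + (b + c) ≡⟨ swap₂ r₁ m b c ⟩
    (c + r₁) + (b + m) ∎)
    where
    a = ⟦ ⊕ H ⟧ v
    b = ⟦ ⊕ H ⟧ (suc v)
    c = ⟦ ⊕ H ⟧ (suc (suc v))
    r₁ = suc v % n
    r₂ = suc (suc v) % n
    swap₁ : ∀ a r b m → (a + r) + (b + m) ≡ (a + b) + (r + m)
    swap₁ = solve-∀
    swap₂ : ∀ r m b c → (r + m) + (b + c) ≡ (c + r) + (b + m)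
    swap₂ = solve-∀

  columnTotal : ℕ → (ℕ → Row) → ℕ → ℕ
  columnTotal zero    row w = 0
  columnTotal (suc t) row w = ⟦ row 0 ⟧ w + columnTotal t (row ∘ suc) w

  diagonalTotal : ℕ → (ℕ → Row) → ℕ → ℕ
  diagonalTotal zero    row y = 0
  diagonalTotal (suc t) row y = ⟦ row 0 ⟧ y + diagonalTotal t (row ∘ suc) (suc y)

  Σ[<]-columnTotal : ∀ t row w → Σ[< t ] (λ i → ⟦ row (toℕ i) ⟧ w) ≡ columnTotal t row w
  Σ[<]-columnTotal zero    row w = refl
  Σ[<]-columnTotal (suc t) row w = cong (⟦ row 0 ⟧ w +_) (Σ[<]-columnTotal t (row ∘ suc) w)

  Σ[<]-diagonalTotal : ∀ t row y → Σ[< t ] (λ i → ⟦ row (toℕ i) ⟧ (toℕ i + y)) ≡ diagonalTotal t row y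
  Σ[<]-diagonalTotal zero    row y = refl
  Σ[<]-diagonalTotal (suc t) row y = cong (⟦ row 0 ⟧ y +_) (begin
    Σ[< t ] (λ i → ⟦ row (suc (toℕ i)) ⟧ (suc (toℕ i + y)))
      ≡⟨ Σ[<]-cong t (λ i → cong ⟦ row (suc (toℕ i)) ⟧ (+-suc (toℕ i) y)) ⟨
    Σ[< t ] (λ i → ⟦ row (suc (toℕ i)) ⟧ (toℕ i + suc y))
      ≡⟨ Σ[<]-diagonalTotal t (row ∘ suc) (suc y) ⟩
    diagonalTotal t (row ∘ suc) (suc y) ∎)

  record Pattern (t : ℕ) : Set where
    field
      row       : ℕ → Row
      columns   : ∀ w → columnTotal t row w ≡ t * m
      diagonals : ∀ y → diagonalTotal t row y ≡ t * m
      mirror    : ∀ i j → i + suc j ≡ t → row j ≡ dual (row i)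

  complement-sum-base : ∀ x y {r} → r ≤ M → x + y ≡ r + m → x + ((M ∸ r) + (y + 0)) ≡ 3 * m
  complement-sum-base x y {r} r≤M x+y≡r+m = begin
    x + ((M ∸ r) + (y + 0))   ≡⟨ shuffle₁ x (M ∸ r) y ⟩
    (M ∸ r) + ((x + y) + 0)   ≡⟨ cong (λ s → (M ∸ r) + (s + 0)) x+y≡r+m ⟩
    (M ∸ r) + ((r + m) + 0)   ≡⟨ shuffle₂ (M ∸ r) r m ⟩
    ((M ∸ r) + r) + (m + 0)   ≡⟨ cong (_+ (m + 0)) (m∸n+n≡m r≤M) ⟩
    M + (m + 0)               ≡⟨ M+-unfold (m + 0) ⟩
    3 * m                     ∎
    where
    shuffle₁ : ∀ x c y → x + (c + (y + 0)) ≡ c + ((x + y) + 0)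
    shuffle₁ = solve-∀
    shuffle₂ : ∀ c r m → c + ((r + m) + 0) ≡ (c + r) + (m + 0)
    shuffle₂ = solve-∀

  complement-sum-step : ∀ a c s {r₁ r₂ u} → r₁ ≤ M → a + r₂ ≡ c + r₁ → c + s ≡ u →
                        a + ((M ∸ r₁) + (r₂ + s)) ≡ m + (m + u)
  complement-sum-step a c s {r₁} {r₂} {u} r₁≤M a+r₂≡c+r₁ c+s≡u = begin
    a + ((M ∸ r₁) + (r₂ + s))  ≡⟨ shuffle₁ a (M ∸ r₁) r₂ s ⟩
    (a + r₂) + ((M ∸ r₁) + s)  ≡⟨ cong (_+ ((M ∸ r₁) + s)) a+r₂≡c+r₁ ⟩
    (c + r₁) + ((M ∸ r₁) + s)  ≡⟨ shuffle₂ c r₁ (M ∸ r₁) s ⟩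
    ((M ∸ r₁) + r₁) + (c + s)  ≡⟨ cong₂ _+_ (m∸n+n≡m r₁≤M) c+s≡u ⟩
    M + u                      ≡⟨ M+-unfold u ⟩
    m + (m + u)                ∎
    where
    shuffle₁ : ∀ a d r s → a + (d + (r + s)) ≡ (a + r) + (d + s)
    shuffle₁ = solve-∀
    shuffle₂ : ∀ c r d s → (c + r) + (d + s) ≡ (d + r) + (c + s)
    shuffle₂ = solve-∀

  oddTail : ℕ → ℕ → Row
  oddTail zero    zero          = ⊖ I
  oddTail zero    (suc _)       = ⊕ H′
  oddTail (suc k) zero          = ⊖ I
  oddTail (suc k) (suc zero)    = ⊕ I
  oddTail (suc k) (suc (suc i)) = oddTail k i

  oddRow : ℕ → ℕ → Row
  oddRow k zero    = ⊕ H
  oddRow k (suc i) = oddTail k i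

  odd-columns : ∀ k w → columnTotal (3 + k * 2) (oddRow k) w ≡ (3 + k * 2) * m
  odd-columns zero    w = complement-sum-base (⟦ ⊕ H ⟧ w) (⟦ ⊕ H′ ⟧ w) (%n≤M w) (half+half′ (w % n))
  odd-columns (suc k) w =
    complement-sum-step (⟦ ⊕ H ⟧ w) (⟦ ⊕ H ⟧ w) (columnTotal (2 + k * 2) (oddTail k) w)
      (%n≤M w) refl (odd-columns k w)

  odd-diagonals : ∀ k y → diagonalTotal (3 + k * 2) (oddRow k) y ≡ (3 + k * 2) * m
  odd-diagonals zero    y = begin
    ⟦ ⊕ H ⟧ y + ((M ∸ suc y % n) + (⟦ ⊕ H′ ⟧ (2 + y) + 0))
      ≡⟨ cong (λ x → ⟦ ⊕ H ⟧ y + ((M ∸ suc y % n) + (x + 0))) (⟦H′⟧-suc (suc y)) ⟩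
    ⟦ ⊕ H ⟧ y + ((M ∸ suc y % n) + (⟦ ⊕ H ⟧ (1 + y) + 0))
      ≡⟨ complement-sum-base (⟦ ⊕ H ⟧ y) (⟦ ⊕ H ⟧ (1 + y)) (%n≤M (suc y)) (⟦H⟧-consecutive y) ⟩
    3 * m ∎
  odd-diagonals (suc k) y =
    complement-sum-step (⟦ ⊕ H ⟧ y) (⟦ ⊕ H ⟧ (2 + y)) (diagonalTotal (2 + k * 2) (oddTail k) (3 + y))
      (%n≤M (suc y)) (⟦H⟧-step y) (odd-diagonals k (2 + y))

  alternating : ℕ → Row
  alternating zero          = ⊖ I
  alternating (suc zero)    = ⊕ I
  alternating (suc (suc i)) = alternating i

  alternating-mirror : ∀ k i j → i + j ≡ k * 2 → alternating j ≡ dual (alternating i)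
  alternating-mirror k zero j refl = even-⊖I k
    where
    even-⊖I : ∀ k → alternating (k * 2) ≡ ⊖ I
    even-⊖I zero    = refl
    even-⊖I (suc k) = even-⊖I k
  alternating-mirror (suc k) (suc zero) .(suc (k * 2)) refl = odd-⊕I k
    where
    odd-⊕I : ∀ k → alternating (suc (k * 2)) ≡ ⊕ I
    odd-⊕I zero    = refl
    odd-⊕I (suc k) = odd-⊕I k
  alternating-mirror (suc k) (suc (suc i)) j e =
    alternating-mirror k i j (suc-injective (suc-injective e))

  oddTail-alternating : ∀ k i → i ≤ k * 2 → oddTail k i ≡ alternating i
  oddTail-alternating zero    zero          _                 = refl
  oddTail-alternating (suc k) zero          _                 = refl
  oddTail-alternating (suc k) (suc zero)    _                 = refl
  oddTail-alternating (suc k) (suc (suc i)) (s≤s (s≤s i≤2k)) = oddTail-alternating k i i≤2k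

  oddTail-last : ∀ k → oddTail k (suc (k * 2)) ≡ ⊕ H′
  oddTail-last zero    = refl
  oddTail-last (suc k) = oddTail-last k

  odd-mirror : ∀ k i j → i + suc j ≡ 3 + k * 2 → oddRow k j ≡ dual (oddRow k i)
  odd-mirror k zero    .(2 + k * 2) refl = oddTail-last k
  odd-mirror k (suc i) zero e = begin
    ⊕ H                            ≡⟨⟩
    dual (⊕ H′)                    ≡⟨ cong dual (oddTail-last k) ⟨
    dual (oddTail k (suc (k * 2))) ≡⟨ cong (dual ∘ oddTail k) i≡1+2k ⟨
    dual (oddTail k i)             ∎
    where
    i≡1+2k : i ≡ suc (k * 2)
    i≡1+2k = suc-injective (trans (+-comm 1 i) (suc-injective e))
  odd-mirror k (suc i) (suc j) e = begin
    oddTail k j          ≡⟨ oddTail-alternating k j (≤-trans (m≤n+m j i) (≤-reflexive i+j≡2k)) ⟩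
    alternating j        ≡⟨ alternating-mirror k i j i+j≡2k ⟩
    dual (alternating i) ≡⟨ cong dual (oddTail-alternating k i (≤-trans (m≤m+n i j) (≤-reflexive i+j≡2k))) ⟨
    dual (oddTail k i)   ∎
    where
    i+j≡2k : i + j ≡ k * 2
    i+j≡2k = suc-injective (suc-injective (begin
      suc (suc (i + j)) ≡⟨ cong suc (+-suc i j) ⟨
      suc (i + suc j)   ≡⟨ +-suc i (suc j) ⟨
      i + suc (suc j)   ≡⟨ suc-injective e ⟩
      suc (suc (k * 2)) ∎))

  oddPattern : ∀ k → Pattern (3 + k * 2)
  oddPattern k = record
    { row = oddRow k ; columns = odd-columns k ; diagonals = odd-diagonals k ; mirror = odd-mirror k }

  pairwise-complement-sum : ∀ x y z w → x + y ≡ M → z + w ≡ M → x + (y + (z + (w + 0))) ≡ 4 * m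
  pairwise-complement-sum x y z w x+y≡M z+w≡M = begin
    x + (y + (z + (w + 0))) ≡⟨ +-assoc x y _ ⟨
    (x + y) + (z + (w + 0)) ≡⟨ cong₂ (λ a b → a + b) x+y≡M (trans (cong (z +_) (+-identityʳ w)) z+w≡M) ⟩
    M + M                   ≡⟨ M+-unfold M ⟩
    m + (m + M)             ≡⟨ cong (λ a → m + (m + a)) (trans (sym (+-identityʳ M)) (M+-unfold 0)) ⟩
    4 * m                   ∎

  fourRow : ℕ → Row
  fourRow 0 = ⊕ H
  fourRow 1 = ⊖ H′
  fourRow 2 = ⊖ H
  fourRow _ = ⊕ H′

  four-columns : ∀ w → columnTotal 4 fourRow w ≡ 4 * m
  four-columns w = begin
    h + ((M ∸ h′) + ((M ∸ h) + (h′ + 0))) ≡⟨ swap h (M ∸ h′) (M ∸ h) h′ ⟩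
    h + ((M ∸ h) + ((M ∸ h′) + (h′ + 0)))
      ≡⟨ pairwise-complement-sum h (M ∸ h) (M ∸ h′) h′ (m+[n∸m]≡n (⟦⟧-≤ (⊕ H) w)) (m∸n+n≡m (⟦⟧-≤ (⊕ H′) w)) ⟩
    4 * m                                 ∎
    where
    h = ⟦ ⊕ H ⟧ w
    h′ = ⟦ ⊕ H′ ⟧ w
    swap : ∀ a b c d → a + (b + (c + (d + 0))) ≡ a + (c + (b + (d + 0)))
    swap = solve-∀

  four-diagonals : ∀ y → diagonalTotal 4 fourRow y ≡ 4 * m
  four-diagonals y = begin
    ⟦ ⊕ H ⟧ y + ((M ∸ ⟦ ⊕ H′ ⟧ (1 + y)) + ((M ∸ ⟦ ⊕ H ⟧ (2 + y)) + (⟦ ⊕ H′ ⟧ (3 + y) + 0)))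
      ≡⟨ cong₂ (λ a b → ⟦ ⊕ H ⟧ y + ((M ∸ a) + ((M ∸ ⟦ ⊕ H ⟧ (2 + y)) + (b + 0))))
               (⟦H′⟧-suc y) (⟦H′⟧-suc (2 + y)) ⟩
    ⟦ ⊕ H ⟧ y + ((M ∸ ⟦ ⊕ H ⟧ y) + ((M ∸ ⟦ ⊕ H ⟧ (2 + y)) + (⟦ ⊕ H ⟧ (2 + y) + 0)))
      ≡⟨ pairwise-complement-sum (⟦ ⊕ H ⟧ y) (M ∸ ⟦ ⊕ H ⟧ y) (M ∸ ⟦ ⊕ H ⟧ (2 + y)) (⟦ ⊕ H ⟧ (2 + y))
           (m+[n∸m]≡n (⟦⟧-≤ (⊕ H) y)) (m∸n+n≡m (⟦⟧-≤ (⊕ H) (2 + y))) ⟩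
    4 * m ∎

  four-mirror : ∀ i j → i + suc j ≡ 4 → fourRow j ≡ dual (fourRow i)
  four-mirror 0 .3 refl = refl
  four-mirror 1 .2 refl = refl
  four-mirror 2 .1 refl = refl
  four-mirror 3 .0 refl = refl
  four-mirror (suc (suc (suc (suc i)))) j e =
    contradiction (suc-injective (suc-injective (suc-injective (suc-injective e)))) (m+1+n≢0 i)

  fourPattern : Pattern 4
  fourPattern = record
    { row = fourRow ; columns = four-columns ; diagonals = four-diagonals ; mirror = four-mirror }

  append : ℕ → (ℕ → Row) → (ℕ → Row) → ℕ → Row
  append zero    r s i       = s i
  append (suc a) r s zero    = r zero
  append (suc a) r s (suc i) = append a (r ∘ suc) s i

  append-< : ∀ a r s {i} → i < a → append a r s i ≡ r i
  append-< (suc a) r s {zero}  _         = refl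
  append-< (suc a) r s {suc i} (s≤s i<a) = append-< a (r ∘ suc) s i<a

  append-+ : ∀ a r s i → append a r s (a + i) ≡ s i
  append-+ zero    r s i = refl
  append-+ (suc a) r s i = append-+ a (r ∘ suc) s i

  columnTotal-append : ∀ a b r s w →
    columnTotal (a + b) (append a r s) w ≡ columnTotal a r w + columnTotal b s w
  columnTotal-append zero    b r s w = refl
  columnTotal-append (suc a) b r s w =
    trans (cong (⟦ r 0 ⟧ w +_) (columnTotal-append a b (r ∘ suc) s w)) (sym (+-assoc (⟦ r 0 ⟧ w) _ _))

  diagonalTotal-append : ∀ a b r s y →
    diagonalTotal (a + b) (append a r s) y ≡ diagonalTotal a r y + diagonalTotal b s (a + y)
  diagonalTotal-append zero    b r s y = refl
  diagonalTotal-append (suc a) b r s y = begin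
    ⟦ r 0 ⟧ y + diagonalTotal (a + b) (append a (r ∘ suc) s) (suc y)
      ≡⟨ cong (⟦ r 0 ⟧ y +_) (diagonalTotal-append a b (r ∘ suc) s (suc y)) ⟩
    ⟦ r 0 ⟧ y + (diagonalTotal a (r ∘ suc) (suc y) + diagonalTotal b s (a + suc y))
      ≡⟨ cong (λ z → ⟦ r 0 ⟧ y + (diagonalTotal a (r ∘ suc) (suc y) + diagonalTotal b s z)) (+-suc a y) ⟩
    ⟦ r 0 ⟧ y + (diagonalTotal a (r ∘ suc) (suc y) + diagonalTotal b s (suc (a + y)))
      ≡⟨ +-assoc (⟦ r 0 ⟧ y) _ _ ⟨
    ⟦ r 0 ⟧ y + diagonalTotal a (r ∘ suc) (suc y) + diagonalTotal b s (suc (a + y)) ∎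

  data Split (a : ℕ) : ℕ → Set where
    low  : ∀ {i} → i < a → Split a i
    high : ∀ i → Split a (a + i)

  split : ∀ a i → Split a i
  split zero    i       = high i
  split (suc a) zero    = low z<s
  split (suc a) (suc i) with split a i
  ... | low i<a = low (s≤s i<a)
  ... | high i′ = high i′

  double-mirror : ∀ a row → (∀ i j → i + suc j ≡ a → row j ≡ dual (row i)) →
                  ∀ i j → i + suc j ≡ a + a → append a row row j ≡ dual (append a row row i)
  double-mirror a row mirror i j e with split a i | split a j
  ... | low i<a | low j<a  = contradiction e (<⇒≢ (+-mono-<-≤ i<a j<a))
  ... | high i′ | high j′ = contradiction e (≢-sym (<⇒≢ a+a<lhs))
    where
    a+a<lhs : a + a < a + i′ + suc (a + j′)
    a+a<lhs = subst (_≤ a + i′ + suc (a + j′)) (+-suc a a) (+-mono-≤ (m≤m+n a i′) (s≤s (m≤m+n a j′)))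
  ... | low {i} i<a | high j′ = begin
    append a row row (a + j′) ≡⟨ append-+ a row row j′ ⟩
    row j′                    ≡⟨ mirror i j′ (+-cancelˡ-≡ a _ _ (trans (regroup a i j′) e)) ⟩
    dual (row i)              ≡⟨ cong dual (append-< a row row i<a) ⟨
    dual (append a row row i) ∎
    where
    regroup : ∀ a i j → a + (i + suc j) ≡ i + suc (a + j)
    regroup = solve-∀
  ... | high i′ | low {j} j<a = begin
    append a row row j               ≡⟨ append-< a row row j<a ⟩
    row j                            ≡⟨ mirror i′ j (+-cancelˡ-≡ a _ _ (trans (sym (+-assoc a i′ (suc j))) e)) ⟩
    dual (row i′)                    ≡⟨ cong dual (append-+ a row row i′) ⟨
    dual (append a row row (a + i′)) ∎

  doublePattern : ∀ {a} → Pattern a → Pattern (a + a)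
  doublePattern {a} p = record
    { row       = append a row row
    ; columns   = λ w → trans (columnTotal-append a a row row w) (twice (columns w) (columns w))
    ; diagonals = λ y → trans (diagonalTotal-append a a row row y)
                              (twice (diagonals y) (diagonals (a + y)))
    ; mirror    = double-mirror a row mirror
    }
    where
    open Pattern p
    twice : ∀ {x y} → x ≡ a * m → y ≡ a * m → x + y ≡ (a + a) * m
    twice x≡ y≡ = trans (cong₂ _+_ x≡ y≡) (sym (*-distribʳ-+ m a a))

  rowPattern : ∀ t → 3 ≤ t → Pattern t
  rowPattern = <-rec (λ t → 3 ≤ t → Pattern t) by-parity
    where
    by-parity : ∀ t → (∀ {s} → s < t → 3 ≤ s → Pattern s) → 3 ≤ t → Pattern t
    by-parity t rec 3≤t with parity t
    ... | odd (suc k)              = oddPattern k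
    ... | even 2                   = fourPattern
    ... | even (suc (suc (suc k))) =
      subst Pattern (a+a≡a*2 (3 + k))
        (doublePattern (rec (m<m*n (3 + k) 2 (s≤s (s≤s z≤n))) (s≤s (s≤s (s≤s z≤n)))))
      where
      a+a≡a*2 : ∀ a → a + a ≡ a * 2
      a+a≡a*2 a = trans (cong (a +_) (sym (+-identityʳ a))) (*-comm 2 a)
    ... | odd zero   = contradiction 3≤t λ { (s≤s ()) }
    ... | even zero  = contradiction 3≤t λ ()
    ... | even 1     = contradiction 3≤t λ { (s≤s (s≤s ())) }

  module Digits {t : ℕ} .{{_ : NonZero t}} (l : ℕ) (p : Pattern t) where
    open Pattern p

    entry : Array t n
    entry i j = suc l + toℕ i + ⟦ row (toℕ i) ⟧ (toℕ j) * t

    entry-digits : ∀ i j → entry i j ≡ suc l + (toℕ i + ⟦ row (toℕ i) ⟧ (toℕ j) * t)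
    entry-digits i j = +-assoc (suc l) (toℕ i) _

    entry-bounds : ∀ i j → (1 + l ≤ entry i j) × (entry i j ≤ n * t + l)
    entry-bounds i j =
      ≤-trans (m≤m+n (suc l) (toℕ i)) (m≤m+n _ _) ,
      subst₂ _≤_ (sym (entry-digits i j)) (+-comm l (n * t))
        (+-monoʳ-< l (+-mono-<-≤ (toℕ<n i) (*-monoˡ-≤ t (⟦⟧-≤ (row (toℕ i)) (toℕ j)))))

    entry-injective : ∀ i j i′ j′ → entry i j ≡ entry i′ j′ → (i ≡ i′) × (j ≡ j′)
    entry-injective i j i′ j′ e
      with digits-injective (⟦ row (toℕ i) ⟧ (toℕ j)) (⟦ row (toℕ i′) ⟧ (toℕ j′)) (toℕ<n i) (toℕ<n i′)
             (+-cancelˡ-≡ (suc l) _ _ (trans (sym (entry-digits i j)) (trans e (entry-digits i′ j′))))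
    ... | i≡i′ , x≡x′ with toℕ-injective i≡i′
    ... | refl = refl , toℕ-injective (⟦⟧-injective (row (toℕ i)) (toℕ<n j) (toℕ<n j′) x≡x′)

    entry-surjective : ∀ v → 1 + l ≤ v → v ≤ n * t + l →
                       Σ (Fin t) (λ i → Σ (Fin n) (λ j → entry i j ≡ v))
    entry-surjective v 1+l≤v v≤nt+l = i , j , (begin
      suc l + toℕ i + ⟦ row (toℕ i) ⟧ (toℕ j) * t
        ≡⟨ cong₂ (λ a b → suc l + a + b * t) (toℕ-fromℕ< (m%n<n u t)) ⟦j⟧≡u/t ⟩
      suc l + u % t + (u / t) * t                 ≡⟨ +-assoc (suc l) (u % t) _ ⟩
      suc l + (u % t + (u / t) * t)               ≡⟨ cong (suc l +_) (m≡m%n+[m/n]*n u t) ⟨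
      suc l + u                                   ≡⟨ m+[n∸m]≡n 1+l≤v ⟩
      v                                           ∎)
      where
      u = v ∸ suc l
      u<nt : u < n * t
      u<nt = +-cancelʳ-≤ l (suc u) (n * t)
               (subst (_≤ n * t + l) (trans (sym (m+[n∸m]≡n 1+l≤v)) (cong suc (+-comm l u))) v≤nt+l)
      i = fromℕ< (m%n<n u t)
      j = proj₁ (⟦⟧-surjective (row (toℕ i)) (<⇒≤pred (m<n*o⇒m/o<n u<nt)))
      ⟦j⟧≡u/t = proj₂ (⟦⟧-surjective (row (toℕ i)) (<⇒≤pred (m<n*o⇒m/o<n u<nt)))

    lineSum : ℕ
    lineSum = Σ[< t ] (λ i → suc l + toℕ i) + t * m * t

    entry-sum : (x : Fin t → ℕ) → Σ[< t ] x ≡ t * m → Σ[< t ] (λ i → suc l + toℕ i + x i * t) ≡ lineSum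
    entry-sum x Σx≡tm = trans (Σ[<]-+-* t (λ i → suc l + toℕ i) x t) (cong (λ s → _ + s * t) Σx≡tm)

    entry-columns : ∀ j → colSum entry j ≡ lineSum
    entry-columns j = entry-sum _ (trans (Σ[<]-columnTotal t row (toℕ j)) (columns (toℕ j)))

    entry-diagonals : ∀ d → diagSum entry d ≡ lineSum
    entry-diagonals d =
      trans (Σ[<]-cong t on-diagonal)
            (entry-sum _ (trans (Σ[<]-diagonalTotal t row (suc (toℕ d))) (diagonals (suc (toℕ d)))))
      where
      on-diagonal : ∀ i → entry i (diagCol d (toℕ i)) ≡
                          suc l + toℕ i + ⟦ row (toℕ i) ⟧ (toℕ i + suc (toℕ d)) * t
      on-diagonal i = cong (λ x → suc l + toℕ i + x * t) (begin
        ⟦ row (toℕ i) ⟧ (toℕ (diagCol d (toℕ i)))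
          ≡⟨ cong ⟦ row (toℕ i) ⟧ (toℕ-fromℕ< (m%n<n (toℕ d + toℕ i + 1) n)) ⟩
        ⟦ row (toℕ i) ⟧ ((toℕ d + toℕ i + 1) % n)
          ≡⟨ ⟦⟧-% (row (toℕ i)) (toℕ d + toℕ i + 1) ⟩
        ⟦ row (toℕ i) ⟧ (toℕ d + toℕ i + 1)
          ≡⟨ cong ⟦ row (toℕ i) ⟧ (regroup (toℕ d) (toℕ i)) ⟩
        ⟦ row (toℕ i) ⟧ (toℕ i + suc (toℕ d)) ∎)
        where
        regroup : ∀ d i → d + i + 1 ≡ i + suc d
        regroup = solve-∀

    entry-symmetric : ∀ i j →
      entry i j + entry (opposite i) (opposite j) ≡ (suc l + suc l) + (pred t + M * t)
    entry-symmetric i j = begin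
      (a + i₀ + x₀ * t) + (a + i₁ + x₁ * t) ≡⟨ regroup a i₀ i₁ x₀ x₁ t ⟩
      (a + a) + ((i₀ + i₁) + (x₀ + x₁) * t) ≡⟨ cong₂ (λ s r → (a + a) + (s + r * t)) i₀+i₁≡t-1 x₀+x₁≡M ⟩
      (a + a) + (pred t + M * t)            ∎
      where
      a = suc l
      i₀ = toℕ i
      i₁ = toℕ (opposite i)
      x₀ = ⟦ row i₀ ⟧ (toℕ j)
      x₁ = ⟦ row i₁ ⟧ (toℕ (opposite j))
      i₀+i₁≡t-1 : i₀ + i₁ ≡ pred t
      i₀+i₁≡t-1 = cong pred (trans (sym (+-suc i₀ i₁)) (toℕ+toℕ-opposite i))
      x₀+x₁≡M : x₀ + x₁ ≡ M
      x₀+x₁≡M = begin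
        x₀ + ⟦ row i₁ ⟧ (toℕ (opposite j))
          ≡⟨ cong (λ r → x₀ + ⟦ r ⟧ (toℕ (opposite j))) (mirror i₀ i₁ (toℕ+toℕ-opposite i)) ⟩
        x₀ + ⟦ dual (row i₀) ⟧ (toℕ (opposite j))
          ≡⟨ cong (λ w → x₀ + ⟦ dual (row i₀) ⟧ w) (opposite-prop j) ⟩
        x₀ + ⟦ dual (row i₀) ⟧ (M ∸ toℕ j)
          ≡⟨ ⟦⟧-dual (row i₀) (<⇒≤pred (toℕ<n j)) ⟩
        M ∎
      regroup : ∀ a i₀ i₁ x₀ x₁ t →
                (a + i₀ + x₀ * t) + (a + i₁ + x₁ * t) ≡ (a + a) + ((i₀ + i₁) + (x₀ + x₁) * t)
      regroup = solve-∀

    isSFD : t ≤ n → IsSFDShifted t n l entry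
    isSFD t≤n = record
      { t≤n          = t≤n
      ; entries-in   = entry-bounds
      ; entries-inj  = entry-injective
      ; entries-onto = entry-surjective
      ; columns      = lineSum , entry-columns
      ; diagonals    = lineSum , entry-diagonals
      ; symmetric    = _ , entry-symmetric
      }

theorem3p5 : (n t l : ℕ) → n % 2 ≡ 1 → 3 ≤ n → 3 ≤ t → t ≤ n →
    Σ (Array t n) (λ A → IsSFDShifted t n l A)
theorem3p5 n t l n-odd _ 3≤t t≤n =
  subst (λ n → Σ (Array t n) (IsSFDShifted t n l)) (sym n≡1+2m) (entry , isSFD (subst (t ≤_) n≡1+2m t≤n))
  where
  n≡1+2m : n ≡ suc (n / 2 * 2)
  n≡1+2m = trans (m≡m%n+[m/n]*n n 2) (cong (_+ n / 2 * 2) n-odd)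
  instance
    t≢0 : NonZero t
    t≢0 = >-nonZero (≤-trans (s≤s z≤n) 3≤t)
  open Modulus (n / 2) using (rowPattern; module Digits)
  open Digits l (rowPattern t 3≤t)
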